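{- Let $s\in\mathbb{Z}$. Then the polynomial $$F_s(t)= t^4 + (4s^3 - 4s^2 + 8s - 4)t^3 + (-6s^2 - 6)t^2 + 4t + 1$$ is irreducible in $\mathbb{Q}[t]$. -}

module Defs where

open import Data.Nat using (ℕ; zero; suc)
open import Data.Integer as ℤ using (ℤ; +_)
open import Data.Rational as ℚ using (ℚ; 0ℚ; 1ℚ)
open import Data.List using (List; []; _∷_; map)
open import Data.Product using (∃)
open import Data.Sum using (_⊎_)
open import Relation.Nullary using (¬_)
open import Relation.Binary.PropositionalEquality using (_≡_)

-- Univariate polynomials over ℚ, represented by their coefficient lists,
-- lowest degree first: a₀ ∷ a₁ ∷ … represents a₀ + a₁ t + ….
-- Trailing zeros are allowed; equality of polynomials is equality of
-- all coefficients (_≈P_ below).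
Poly : Set
Poly = List ℚ

coeff : Poly → ℕ → ℚ
coeff []      n       = 0ℚ
coeff (a ∷ p) zero    = a
coeff (a ∷ p) (suc n) = coeff p n

_≈P_ : Poly → Poly → Set
p ≈P q = ∀ n → coeff p n ≡ coeff q n

infix 4 _≈P_
infixl 6 _+P_
infixl 7 _*P_

_+P_ : Poly → Poly → Poly
[]      +P q       = q
(a ∷ p) +P []      = a ∷ p
(a ∷ p) +P (b ∷ q) = (a ℚ.+ b) ∷ (p +P q)

_*P_ : Poly → Poly → Poly
[]      *P q = []
(a ∷ p) *P q = map (a ℚ.*_) q +P (0ℚ ∷ (p *P q))

0P : Poly
0P = []

1P : Poly
1P = 1ℚ ∷ []

IsUnit : Poly → Set
IsUnit p = ∃ λ q → p *P q ≈P 1P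

Irreducible : Poly → Set
Irreducible f = ¬ (f ≈P 0P) × ¬ IsUnit f × (∀ g h → f ≈P g *P h → IsUnit g ⊎ IsUnit h)
  where open import Data.Product using (_×_)

ι : ℤ → ℚ
ι z = z ℚ./ 1

F : ℤ → Poly
F s = ι (+ 1)
    ∷ ι (+ 4)
    ∷ ι (ℤ.- (+ 6) ℤ.* s ℤ.* s ℤ.- + 6)
    ∷ ι (+ 4 ℤ.* s ℤ.* s ℤ.* s ℤ.- + 4 ℤ.* s ℤ.* s ℤ.+ + 8 ℤ.* s ℤ.- + 4)
    ∷ ι (+ 1)
    ∷ []

{-# OPTIONS --safe #-}
module Submission where

-- Write F_s = t⁴ + β t³ + α t² + 4t + 1. A factorisation over ℚ is, up to
-- units, linear × cubic or quadratic × quadratic. A linear factor gives a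
-- rational root of the monic integer polynomial F_s, hence an integer root;
-- but F_s(z) is never 0 modulo 8. If F_s = (t² + at + b)(t² + ct + d), then
-- b + d is a root of a monic integer resolvent cubic, hence an integer; so b
-- and d are the integer roots of t² − (b + d)t + 1, i.e. b = d = ±1, and a is
-- an integer root of t² − βt + α − 2b. For b = d = 1 comparing the t- and
-- t³-coefficients also forces β = 4, which together with that quadratic is
-- impossible modulo 5; for b = d = −1 the quadratic has no root modulo 3.

open import Defs
open import Data.Nat as ℕ using (ℕ; zero; suc; s≤s)
import Data.Nat.Properties as ℕP
import Data.Nat.Divisibility as ℕD
import Data.Nat.Coprimality as ℕC
open import Data.Integer as ℤ using (ℤ; +_; 0ℤ; 1ℤ; -1ℤ)
import Data.Integer.Properties as ℤP
import Data.Integer.DivMod as ℤM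
import Data.Integer.Divisibility as ℤD
import Data.Integer.Coprimality as ℤC
open import Data.Integer.Divisibility.Signed
  using (_∣_; _∣?_; divides; ∣-refl; ∣⇒∣ᵤ; ∣m∣n⇒∣m+n; ∣m⇒∣-m; ∣n⇒∣m*n; ∣m⇒∣m*n; ∣m+n∣n⇒∣m)
open import Data.Integer.Tactic.RingSolver using () renaming (solve-∀ to solveℤ)
open import Data.Rational as ℚ using (ℚ; 0ℚ; 1ℚ; mkℚ; _+_; _*_; -_; _-_)
import Data.Rational.Properties as ℚP
import Data.Rational.Unnormalised as ℚᵘ
import Data.Rational.Unnormalised.Properties as ℚᵘP
open import Data.Fin using (Fin; toℕ; fromℕ<)
open import Data.Fin.Properties using (all?; toℕ-fromℕ<)
open import Data.List using (List; []; _∷_; length; map)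
open import Data.Product using (∃; _,_; _×_)
open import Data.Sum as ⊎ using (_⊎_; inj₁; inj₂)
open import Data.Empty using (⊥; ⊥-elim)
open import Function using (_∘_)
open import Level using (0ℓ)
open import Relation.Binary.Definitions using (tri<; tri≈; tri>)
open import Relation.Binary.PropositionalEquality
open import Relation.Nullary using (¬_; Dec; yes; no; contradiction)
open import Relation.Nullary.Decidable using (from-yes; ¬?; _×-dec_; dec⇒maybe)
open import Tactic.RingSolver using (solve-∀)
open import Tactic.RingSolver.Core.AlmostCommutativeRing
  using (AlmostCommutativeRing; fromCommutativeRing)

ℚ-ring : AlmostCommutativeRing 0ℓ 0ℓ
ℚ-ring = fromCommutativeRing ℚP.+-*-commutativeRing (λ x → dec⇒maybe (0ℚ ℚ.≟ x))

ι-toℚᵘ : ∀ z → ℚ.toℚᵘ (ι z) ℚᵘ.≃ ℚᵘ.mkℚᵘ z 0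
ι-toℚᵘ z = ℚP.toℚᵘ-fromℚᵘ (ℚᵘ.mkℚᵘ z 0)

ι-homo-+ : ∀ a b → ι (a ℤ.+ b) ≡ ι a + ι b
ι-homo-+ a b = ℚP.toℚᵘ-injective (begin
  ℚ.toℚᵘ (ι (a ℤ.+ b))                  ≈⟨ ι-toℚᵘ (a ℤ.+ b) ⟩
  ℚᵘ.mkℚᵘ (a ℤ.+ b) 0                    ≈⟨ ℚᵘ.*≡* (cross a b) ⟩
  ℚᵘ.mkℚᵘ a 0 ℚᵘ.+ ℚᵘ.mkℚᵘ b 0          ≈⟨ ℚᵘP.+-cong (ι-toℚᵘ a) (ι-toℚᵘ b) ⟨
  ℚ.toℚᵘ (ι a) ℚᵘ.+ ℚ.toℚᵘ (ι b)        ≈⟨ ℚP.toℚᵘ-homo-+ (ι a) (ι b) ⟨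
  ℚ.toℚᵘ (ι a + ι b)                     ∎)
  where
  open ℚᵘP.≃-Reasoning
  cross : ∀ a b → (a ℤ.+ b) ℤ.* + 1 ≡ (a ℤ.* + 1 ℤ.+ b ℤ.* + 1) ℤ.* + 1
  cross = solveℤ

ι-homo-* : ∀ a b → ι (a ℤ.* b) ≡ ι a * ι b
ι-homo-* a b = ℚP.toℚᵘ-injective (begin
  ℚ.toℚᵘ (ι (a ℤ.* b))                  ≈⟨ ι-toℚᵘ (a ℤ.* b) ⟩
  ℚᵘ.mkℚᵘ a 0 ℚᵘ.* ℚᵘ.mkℚᵘ b 0          ≈⟨ ℚᵘP.*-cong (ι-toℚᵘ a) (ι-toℚᵘ b) ⟨
  ℚ.toℚᵘ (ι a) ℚᵘ.* ℚ.toℚᵘ (ι b)        ≈⟨ ℚP.toℚᵘ-homo-* (ι a) (ι b) ⟨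
  ℚ.toℚᵘ (ι a * ι b)                     ∎)
  where open ℚᵘP.≃-Reasoning

ι-homo‿- : ∀ a → ι (ℤ.- a) ≡ - ι a
ι-homo‿- a = ℚP.toℚᵘ-injective (begin
  ℚ.toℚᵘ (ι (ℤ.- a))   ≈⟨ ι-toℚᵘ (ℤ.- a) ⟩
  ℚᵘ.- ℚᵘ.mkℚᵘ a 0     ≈⟨ ℚᵘP.-‿cong (ι-toℚᵘ a) ⟨
  ℚᵘ.- ℚ.toℚᵘ (ι a)    ≈⟨ ℚP.toℚᵘ-homo‿- (ι a) ⟨
  ℚ.toℚᵘ (- ι a)        ∎)
  where open ℚᵘP.≃-Reasoning

ι-homo-- : ∀ a b → ι (a ℤ.- b) ≡ ι a - ι b
ι-homo-- a b = trans (ι-homo-+ a (ℤ.- b)) (cong (_+_ (ι a)) (ι-homo‿- b))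

ι-injective : ∀ {a b} → ι a ≡ ι b → a ≡ b
ι-injective {a} {b} eq with ℚP.fromℚᵘ-injective {ℚᵘ.mkℚᵘ a 0} {ℚᵘ.mkℚᵘ b 0} eq
... | ℚᵘ.*≡* a≡b = trans (sym (ℤP.*-identityʳ a)) (trans a≡b (ℤP.*-identityʳ b))

-- Monic integer polynomials and the rational root theorem

-- c₀ ∷ c₁ ∷ ⋯ ∷ cₙ₋₁ stands for c₀ + c₁ t + ⋯ + cₙ₋₁ tⁿ⁻¹ + tⁿ.
evalMonic : List ℤ → ℚ → ℚ
evalMonic []       x = 1ℚ
evalMonic (c ∷ cs) x = ι c + x * evalMonic cs x

evalMonicℤ : List ℤ → ℤ → ℤ
evalMonicℤ []       z = 1ℤ
evalMonicℤ (c ∷ cs) z = c ℤ.+ z ℤ.* evalMonicℤ cs z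

evalMonic-ι : ∀ cs z → evalMonic cs (ι z) ≡ ι (evalMonicℤ cs z)
evalMonic-ι []       z = refl
evalMonic-ι (c ∷ cs) z = begin
  ι c + ι z * evalMonic cs (ι z)    ≡⟨ cong (λ v → ι c + ι z * v) (evalMonic-ι cs z) ⟩
  ι c + ι z * ι (evalMonicℤ cs z)   ≡⟨ cong (_+_ (ι c)) (ι-homo-* z (evalMonicℤ cs z)) ⟨
  ι c + ι (z ℤ.* evalMonicℤ cs z)   ≡⟨ ι-homo-+ c (z ℤ.* evalMonicℤ cs z) ⟨
  ι (evalMonicℤ (c ∷ cs) z)         ∎
  where open ≡-Reasoning

cofactor : List ℤ → ℤ → ℤ → ℤ
cofactor []       n d = 0ℤ
cofactor (c ∷ cs) n d = c ℤ.* d ℤ.^ length cs ℤ.+ n ℤ.* cofactor cs n d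

clear-denominator : ∀ cs {x n d} → x * ι d ≡ ι n →
  ι (n ℤ.^ length cs ℤ.+ d ℤ.* cofactor cs n d) ≡ ι (d ℤ.^ length cs) * evalMonic cs x
clear-denominator []               {d = d} _    = cong (λ v → ι (1ℤ ℤ.+ v)) (ℤP.*-zeroʳ d)
clear-denominator (c ∷ cs) {x} {n} {d} x*d≡n = begin
  ι (n ℤ.* N ℤ.+ d ℤ.* (c ℤ.* D ℤ.+ n ℤ.* R))
    ≡⟨ cong ι (regroup n d c N D R) ⟩
  ι (n ℤ.* (N ℤ.+ d ℤ.* R) ℤ.+ c ℤ.* (d ℤ.* D))
    ≡⟨ ι-homo-+ (n ℤ.* (N ℤ.+ d ℤ.* R)) (c ℤ.* (d ℤ.* D)) ⟩
  ι (n ℤ.* (N ℤ.+ d ℤ.* R)) + ι (c ℤ.* (d ℤ.* D))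
    ≡⟨ cong₂ _+_ (ι-homo-* n (N ℤ.+ d ℤ.* R))
                 (trans (ι-homo-* c (d ℤ.* D)) (cong (ι c *_) (ι-homo-* d D))) ⟩
  ι n * ι (N ℤ.+ d ℤ.* R) + ι c * (ι d * ι D)
    ≡⟨ cong₂ (λ u v → u * v + ι c * (ι d * ι D)) (sym x*d≡n) (clear-denominator cs x*d≡n) ⟩
  x * ι d * (ι D * M) + ι c * (ι d * ι D)
    ≡⟨ factor x (ι d) (ι D) (ι c) M ⟩
  ι d * ι D * (ι c + x * M)
    ≡⟨ cong (_* (ι c + x * M)) (ι-homo-* d D) ⟨
  ι (d ℤ.* D) * evalMonic (c ∷ cs) x
    ∎
  where
  open ≡-Reasoning
  N = n ℤ.^ length cs
  D = d ℤ.^ length cs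
  R = cofactor cs n d
  M = evalMonic cs x
  regroup : ∀ n d c N D R → n ℤ.* N ℤ.+ d ℤ.* (c ℤ.* D ℤ.+ n ℤ.* R)
                          ≡ n ℤ.* (N ℤ.+ d ℤ.* R) ℤ.+ c ℤ.* (d ℤ.* D)
  regroup = solveℤ
  factor : ∀ x δ Δ c M → x * δ * (Δ * M) + c * (δ * Δ) ≡ δ * Δ * (c + x * M)
  factor = solve-∀ ℚ-ring

coprime-divisor-^ : ∀ {d n} k → ℤC.Coprime d n → d ℤD.∣ n ℤ.^ k → d ℤD.∣ 1ℤ
coprime-divisor-^ zero            _   d∣1  = d∣1
coprime-divisor-^ {d} {n} (suc k) cop d∣nᵏ =
  coprime-divisor-^ {d} {n} k cop (ℤC.coprime-divisor d n (n ℤ.^ k) cop d∣nᵏ)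

rational-root-theorem : ∀ cs x → evalMonic cs x ≡ 0ℚ → ∃ λ z → x ≡ ι z
rational-root-theorem cs x@(mkℚ n d-1 cop) root = n , x≡n/1
  where
  d = + suc d-1
  L = length cs
  x*d≡n : x * ι d ≡ ι n
  x*d≡n = ℚP.toℚᵘ-injective (begin
    ℚ.toℚᵘ (x * ι d)                     ≈⟨ ℚP.toℚᵘ-homo-* x (ι d) ⟩
    ℚᵘ.mkℚᵘ n d-1 ℚᵘ.* ℚ.toℚᵘ (ι d)      ≈⟨ ℚᵘP.*-congˡ {ℚᵘ.mkℚᵘ n d-1} (ι-toℚᵘ d) ⟩
    ℚᵘ.mkℚᵘ n d-1 ℚᵘ.* ℚᵘ.mkℚᵘ d 0       ≈⟨ ℚᵘ.*≡* cancel ⟩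
    ℚᵘ.mkℚᵘ n 0                           ≈⟨ ι-toℚᵘ n ⟨
    ℚ.toℚᵘ (ι n)                         ∎)
    where
    open ℚᵘP.≃-Reasoning
    cancel : (n ℤ.* d) ℤ.* 1ℤ ≡ n ℤ.* + suc (d-1 ℕ.* 1)
    cancel = trans (ℤP.*-identityʳ _) (cong (λ k → n ℤ.* + suc k) (sym (ℕP.*-identityʳ d-1)))
  cleared≡0 : n ℤ.^ L ℤ.+ d ℤ.* cofactor cs n d ≡ 0ℤ
  cleared≡0 = ι-injective (begin
    ι (n ℤ.^ L ℤ.+ d ℤ.* cofactor cs n d)    ≡⟨ clear-denominator cs x*d≡n ⟩
    ι (d ℤ.^ L) * evalMonic cs x            ≡⟨ cong (ι (d ℤ.^ L) *_) root ⟩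
    ι (d ℤ.^ L) * 0ℚ                        ≡⟨ ℚP.*-zeroʳ (ι (d ℤ.^ L)) ⟩
    0ℚ                                      ∎)
    where open ≡-Reasoning
  d∣nᴸ : d ℤD.∣ n ℤ.^ L
  d∣nᴸ = ∣⇒∣ᵤ (∣m+n∣n⇒∣m {d} {n ℤ.^ L} (subst (d ∣_) (sym cleared≡0) (divides 0ℤ refl))
                          (∣m⇒∣m*n (cofactor cs n d) ∣-refl))
  d≡1 : suc d-1 ≡ 1
  d≡1 = ℕD.∣1⇒≡1 (coprime-divisor-^ {d} {n} L (ℕC.sym (ℕC.recompute cop)) d∣nᴸ)
  x≡n/1 : x ≡ ι n
  x≡n/1 = trans (sym (ℚP.↥p/↧p≡p x)) (cong (λ k → n ℚ./ suc k) (ℕP.suc-injective d≡1))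

monic-root-integral : ∀ cs x → evalMonic cs x ≡ 0ℚ → ∃ λ z → x ≡ ι z × evalMonicℤ cs z ≡ 0ℤ
monic-root-integral cs x root with rational-root-theorem cs x root
... | z , refl = z , refl , ι-injective (trans (sym (evalMonic-ι cs z)) root)

-- Reduction modulo m

infix 4 _≡_mod_
record _≡_mod_ (a b : ℤ) (m : ℕ) : Set where
  constructor mod∣
  field ∣-difference : + m ∣ a ℤ.- b

module _ {m : ℕ} where

  mod-refl : ∀ a → a ≡ a mod m
  mod-refl a = mod∣ (divides 0ℤ (ℤP.+-inverseʳ a))

  mod-+ : ∀ {a a′ b b′} → a ≡ a′ mod m → b ≡ b′ mod m → a ℤ.+ b ≡ a′ ℤ.+ b′ mod m
  mod-+ {a} {a′} {b} {b′} (mod∣ a≡a′) (mod∣ b≡b′) =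
    mod∣ (subst (+ m ∣_) (regroup a a′ b b′) (∣m∣n⇒∣m+n a≡a′ b≡b′))
    where
    regroup : ∀ a a′ b b′ → (a ℤ.- a′) ℤ.+ (b ℤ.- b′) ≡ (a ℤ.+ b) ℤ.- (a′ ℤ.+ b′)
    regroup = solveℤ

  mod-* : ∀ {a a′ b b′} → a ≡ a′ mod m → b ≡ b′ mod m → a ℤ.* b ≡ a′ ℤ.* b′ mod m
  mod-* {a} {a′} {b} {b′} (mod∣ a≡a′) (mod∣ b≡b′) =
    mod∣ (subst (+ m ∣_) (regroup a a′ b b′) (∣m∣n⇒∣m+n (∣n⇒∣m*n a b≡b′) (∣m⇒∣m*n b′ a≡a′)))
    where
    regroup : ∀ a a′ b b′ → a ℤ.* (b ℤ.- b′) ℤ.+ (a ℤ.- a′) ℤ.* b′ ≡ a ℤ.* b ℤ.- a′ ℤ.* b′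
    regroup = solveℤ

  mod-neg : ∀ {a a′} → a ≡ a′ mod m → ℤ.- a ≡ ℤ.- a′ mod m
  mod-neg {a} {a′} (mod∣ a≡a′) = mod∣ (subst (+ m ∣_) (regroup a a′) (∣m⇒∣-m a≡a′))
    where
    regroup : ∀ a a′ → ℤ.- (a ℤ.- a′) ≡ ℤ.- a ℤ.- ℤ.- a′
    regroup = solveℤ

  residue : .{{_ : ℕ.NonZero m}} → ∀ x → ∃ λ (i : Fin m) → + toℕ i ≡ x mod m
  residue x = fromℕ< r<m , subst (λ r → + r ≡ x mod m) (sym (toℕ-fromℕ< r<m)) r≡x
    where
    r<m = ℤM.n%ℕd<d x m
    r = x ℤM.%ℕ m
    q = x ℤM./ℕ m
    r≡x : + r ≡ x mod m
    r≡x = subst (λ v → + r ≡ v mod m) (sym (ℤM.a≡a%ℕn+[a/ℕn]*n x m))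
            (mod∣ (subst (+ m ∣_) (cancel (+ r) (q ℤ.* + m)) (∣m⇒∣-m (∣n⇒∣m*n q ∣-refl))))
      where
      cancel : ∀ r k → ℤ.- k ≡ r ℤ.- (r ℤ.+ k)
      cancel = solveℤ

data Expr : Set where
  x̂ ŷ : Expr
  con : ℤ → Expr
  _⊕_ _⊗_ : Expr → Expr → Expr
  ⊝_ : Expr → Expr

infixl 6 _⊕_ _⊖_
infixl 7 _⊗_
infix  8 ⊝_

_⊖_ : Expr → Expr → Expr
e ⊖ f = e ⊕ ⊝ f

⟦_⟧ : Expr → ℤ → ℤ → ℤ
⟦ x̂ ⟧     x y = x
⟦ ŷ ⟧     x y = y
⟦ con c ⟧ x y = c
⟦ e ⊕ f ⟧ x y = ⟦ e ⟧ x y ℤ.+ ⟦ f ⟧ x y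
⟦ e ⊗ f ⟧ x y = ⟦ e ⟧ x y ℤ.* ⟦ f ⟧ x y
⟦ ⊝ e ⟧   x y = ℤ.- ⟦ e ⟧ x y

⟦⟧-mod : ∀ e {m x x′ y y′} → x ≡ x′ mod m → y ≡ y′ mod m → ⟦ e ⟧ x y ≡ ⟦ e ⟧ x′ y′ mod m
⟦⟧-mod x̂       x≡ _  = x≡
⟦⟧-mod ŷ       _  y≡ = y≡
⟦⟧-mod (con c) _  _  = mod-refl c
⟦⟧-mod (e ⊕ f) x≡ y≡ = mod-+ (⟦⟧-mod e x≡ y≡) (⟦⟧-mod f x≡ y≡)
⟦⟧-mod (e ⊗ f) x≡ y≡ = mod-* (⟦⟧-mod e x≡ y≡) (⟦⟧-mod f x≡ y≡)
⟦⟧-mod (⊝ e)   x≡ y≡ = mod-neg (⟦⟧-mod e x≡ y≡)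

NoCommonRootMod : ℕ → Expr → Expr → Set
NoCommonRootMod m e f = ∀ (i j : Fin m) →
  ¬ (+ m ∣ ⟦ e ⟧ (+ toℕ i) (+ toℕ j) × + m ∣ ⟦ f ⟧ (+ toℕ i) (+ toℕ j))

noCommonRootMod? : ∀ m e f → Dec (NoCommonRootMod m e f)
noCommonRootMod? m e f = all? λ i → all? λ j → ¬? (_ ∣? _ ×-dec _ ∣? _)

no-common-root : ∀ m .{{_ : ℕ.NonZero m}} e f → NoCommonRootMod m e f →
                 ∀ x y → ⟦ e ⟧ x y ≡ 0ℤ → ⟦ f ⟧ x y ≡ 0ℤ → ⊥
no-common-root m e f none x y e≡0 f≡0 with residue x | residue y
... | i , i≡x | j , j≡y = none i j (root e e≡0 , root f f≡0)
  where
  root : ∀ g → ⟦ g ⟧ x y ≡ 0ℤ → + m ∣ ⟦ g ⟧ (+ toℕ i) (+ toℕ j)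
  root g g≡0 with ⟦⟧-mod g i≡x j≡y
  ... | mod∣ m∣g[i,j]-g[x,y] rewrite g≡0 = subst (+ m ∣_) (ℤP.+-identityʳ _) m∣g[i,j]-g[x,y]

-- Polynomials over ℚ

≈P-sym : ∀ p q → p ≈P q → q ≈P p
≈P-sym _ _ p≈q n = sym (p≈q n)

≈P-trans : ∀ p q r → p ≈P q → q ≈P r → p ≈P r
≈P-trans _ _ _ p≈q q≈r n = trans (p≈q n) (q≈r n)

∷-cong : ∀ {a b p q} → a ≡ b → p ≈P q → a ∷ p ≈P b ∷ q
∷-cong a≡b _   zero    = a≡b
∷-cong _   p≈q (suc n) = p≈q n

∷-zero : ∀ {a p} → a ≡ 0ℚ → p ≈P 0P → a ∷ p ≈P 0P
∷-zero a≡0 _   zero    = a≡0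
∷-zero _   p≈0 (suc n) = p≈0 n

coeff-+P : ∀ p q n → coeff (p +P q) n ≡ coeff p n + coeff q n
coeff-+P []      q       n       = sym (ℚP.+-identityˡ (coeff q n))
coeff-+P (a ∷ p) []      n       = sym (ℚP.+-identityʳ (coeff (a ∷ p) n))
coeff-+P (a ∷ p) (b ∷ q) zero    = refl
coeff-+P (a ∷ p) (b ∷ q) (suc n) = coeff-+P p q n

coeff-scale : ∀ a q n → coeff (map (a *_) q) n ≡ a * coeff q n
coeff-scale a []      n       = sym (ℚP.*-zeroʳ a)
coeff-scale a (b ∷ q) zero    = refl
coeff-scale a (b ∷ q) (suc n) = coeff-scale a q n

coeff-∷-*P : ∀ a p q n → coeff ((a ∷ p) *P q) n ≡ a * coeff q n + coeff (0ℚ ∷ p *P q) n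
coeff-∷-*P a p q n = trans (coeff-+P (map (a *_) q) (0ℚ ∷ p *P q) n)
                           (cong (_+ coeff (0ℚ ∷ p *P q) n) (coeff-scale a q n))

*P-zeroˡ : ∀ p q → p ≈P 0P → p *P q ≈P 0P
*P-zeroˡ []      q _   _ = refl
*P-zeroˡ (a ∷ p) q p≈0 n = begin
  coeff ((a ∷ p) *P q) n                  ≡⟨ coeff-∷-*P a p q n ⟩
  a * coeff q n + coeff (0ℚ ∷ p *P q) n   ≡⟨ cong₂ (λ u v → u * coeff q n + v) (p≈0 0)
                                               (∷-zero refl (*P-zeroˡ p q (p≈0 ∘ suc)) n) ⟩
  0ℚ * coeff q n + 0ℚ                     ≡⟨ cong (_+ 0ℚ) (ℚP.*-zeroˡ (coeff q n)) ⟩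
  0ℚ                                      ∎
  where open ≡-Reasoning


*P-congˡ : ∀ p p′ q → p ≈P p′ → p *P q ≈P p′ *P q
*P-congˡ []      p′        q p≈p′ = ≈P-sym (p′ *P q) 0P (*P-zeroˡ p′ q (≈P-sym 0P p′ p≈p′))
*P-congˡ (a ∷ p) []        q p≈p′ = *P-zeroˡ (a ∷ p) q p≈p′
*P-congˡ (a ∷ p) (a′ ∷ p′) q p≈p′ n = begin
  coeff ((a ∷ p) *P q) n                     ≡⟨ coeff-∷-*P a p q n ⟩
  a * coeff q n + coeff (0ℚ ∷ p *P q) n      ≡⟨ cong₂ (λ u v → u * coeff q n + v) (p≈p′ 0)
                                                  (∷-cong refl (*P-congˡ p p′ q (p≈p′ ∘ suc)) n) ⟩
  a′ * coeff q n + coeff (0ℚ ∷ p′ *P q) n    ≡⟨ coeff-∷-*P a′ p′ q n ⟨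
  coeff ((a′ ∷ p′) *P q) n                   ∎
  where open ≡-Reasoning

*P-congʳ : ∀ p q q′ → q ≈P q′ → p *P q ≈P p *P q′
*P-congʳ []      _ _  _    _ = refl
*P-congʳ (a ∷ p) q q′ q≈q′ n = begin
  coeff ((a ∷ p) *P q) n                     ≡⟨ coeff-∷-*P a p q n ⟩
  a * coeff q n + coeff (0ℚ ∷ p *P q) n      ≡⟨ cong₂ (λ u v → a * u + v) (q≈q′ n)
                                                  (∷-cong refl (*P-congʳ p q q′ q≈q′) n) ⟩
  a * coeff q′ n + coeff (0ℚ ∷ p *P q′) n    ≡⟨ coeff-∷-*P a p q′ n ⟨
  coeff ((a ∷ p) *P q′) n                    ∎
  where open ≡-Reasoning

*P-zeroʳ : ∀ p q → q ≈P 0P → p *P q ≈P 0P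
*P-zeroʳ p q q≈0 = ≈P-trans (p *P q) (p *P 0P) 0P (*P-congʳ p q 0P q≈0) (*0 p)
  where
  *0 : ∀ p → p *P 0P ≈P 0P
  *0 []      _       = refl
  *0 (a ∷ p) zero    = refl
  *0 (a ∷ p) (suc n) = *0 p n

eval : Poly → ℚ → ℚ
eval []      x = 0ℚ
eval (a ∷ p) x = a + x * eval p x

eval-+P : ∀ p q x → eval (p +P q) x ≡ eval p x + eval q x
eval-+P []      q       x = sym (ℚP.+-identityˡ _)
eval-+P (a ∷ p) []      x = sym (ℚP.+-identityʳ _)
eval-+P (a ∷ p) (b ∷ q) x =
  trans (cong (λ v → a + b + x * v) (eval-+P p q x)) (regroup a b x (eval p x) (eval q x))
  where
  regroup : ∀ a b x u v → a + b + x * (u + v) ≡ a + x * u + (b + x * v)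
  regroup = solve-∀ ℚ-ring

eval-scale : ∀ a q x → eval (map (a *_) q) x ≡ a * eval q x
eval-scale a []      x = sym (ℚP.*-zeroʳ a)
eval-scale a (b ∷ q) x =
  trans (cong (λ v → a * b + x * v) (eval-scale a q x)) (regroup a b x (eval q x))
  where
  regroup : ∀ a b x v → a * b + x * (a * v) ≡ a * (b + x * v)
  regroup = solve-∀ ℚ-ring

eval-*P : ∀ p q x → eval (p *P q) x ≡ eval p x * eval q x
eval-*P []      q x = sym (ℚP.*-zeroˡ (eval q x))
eval-*P (a ∷ p) q x = begin
  eval (map (a *_) q +P (0ℚ ∷ p *P q)) x           ≡⟨ eval-+P (map (a *_) q) (0ℚ ∷ p *P q) x ⟩
  eval (map (a *_) q) x + (0ℚ + x * eval (p *P q) x) ≡⟨ cong₂ (λ u v → u + (0ℚ + x * v))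
                                                         (eval-scale a q x) (eval-*P p q x) ⟩
  a * eval q x + (0ℚ + x * (eval p x * eval q x))  ≡⟨ regroup a x (eval p x) (eval q x) ⟩
  (a + x * eval p x) * eval q x                    ∎
  where
  open ≡-Reasoning
  regroup : ∀ a x u v → a * v + (0ℚ + x * (u * v)) ≡ (a + x * u) * v
  regroup = solve-∀ ℚ-ring

eval-zero : ∀ p x → p ≈P 0P → eval p x ≡ 0ℚ
eval-zero []      x _   = refl
eval-zero (a ∷ p) x p≈0 = begin
  a + x * eval p x   ≡⟨ cong₂ (λ u v → u + x * v) (p≈0 0) (eval-zero p x (p≈0 ∘ suc)) ⟩
  0ℚ + x * 0ℚ        ≡⟨ cong (_+_ 0ℚ) (ℚP.*-zeroʳ x) ⟩
  0ℚ                 ∎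
  where open ≡-Reasoning

eval-cong : ∀ p q x → p ≈P q → eval p x ≡ eval q x
eval-cong []      q       x p≈q = sym (eval-zero q x (≈P-sym 0P q p≈q))
eval-cong (a ∷ p) []      x p≈q = eval-zero (a ∷ p) x p≈q
eval-cong (a ∷ p) (b ∷ q) x p≈q = cong₂ (λ u v → u + x * v) (p≈q 0) (eval-cong p q x (p≈q ∘ suc))

root-of-factorˡ : ∀ f g h x → f ≈P g *P h → eval g x ≡ 0ℚ → eval f x ≡ 0ℚ
root-of-factorˡ f g h x f≈gh gx≡0 = begin
  eval f x               ≡⟨ eval-cong f (g *P h) x f≈gh ⟩
  eval (g *P h) x        ≡⟨ eval-*P g h x ⟩
  eval g x * eval h x    ≡⟨ cong (_* eval h x) gx≡0 ⟩
  0ℚ * eval h x          ≡⟨ ℚP.*-zeroˡ (eval h x) ⟩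
  0ℚ                     ∎
  where open ≡-Reasoning

root-of-factorʳ : ∀ f g h x → f ≈P g *P h → eval h x ≡ 0ℚ → eval f x ≡ 0ℚ
root-of-factorʳ f g h x f≈gh hx≡0 = begin
  eval f x               ≡⟨ eval-cong f (g *P h) x f≈gh ⟩
  eval (g *P h) x        ≡⟨ eval-*P g h x ⟩
  eval g x * eval h x    ≡⟨ cong (eval g x *_) hx≡0 ⟩
  eval g x * 0ℚ          ≡⟨ ℚP.*-zeroʳ (eval g x) ⟩
  0ℚ                     ∎
  where open ≡-Reasoning

root-of-linear : ∀ g₀ g₁ {u} → g₁ * u ≡ 1ℚ → eval (g₀ ∷ g₁ ∷ []) (- (g₀ * u)) ≡ 0ℚ
root-of-linear g₀ g₁ {u} g₁u≡1 = begin
  g₀ + - (g₀ * u) * (g₁ + - (g₀ * u) * 0ℚ)   ≡⟨ expand g₀ g₁ u ⟩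
  g₀ * (1ℚ - g₁ * u)                          ≡⟨ cong (λ v → g₀ * (1ℚ - v)) g₁u≡1 ⟩
  g₀ * 0ℚ                                     ≡⟨ ℚP.*-zeroʳ g₀ ⟩
  0ℚ                                          ∎
  where
  open ≡-Reasoning
  expand : ∀ g₀ g₁ u → g₀ + - (g₀ * u) * (g₁ + - (g₀ * u) * 0ℚ) ≡ g₀ * (1ℚ - g₁ * u)
  expand = solve-∀ ℚ-ring

LeadingNonZero : Poly → Set
LeadingNonZero []          = ⊥
LeadingNonZero (a ∷ [])    = a ≢ 0ℚ
LeadingNonZero (_ ∷ b ∷ p) = LeadingNonZero (b ∷ p)

LeadingNonZero-∷ : ∀ a q → LeadingNonZero q → LeadingNonZero (a ∷ q)
LeadingNonZero-∷ a (b ∷ q) lnz = lnz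

trim : ∀ p → (∃ λ q → p ≈P q × LeadingNonZero q) ⊎ p ≈P 0P
trim []      = inj₂ (λ _ → refl)
trim (a ∷ p) with trim p
... | inj₁ (q , p≈q , lnz) = inj₁ (a ∷ q , ∷-cong refl p≈q , LeadingNonZero-∷ a q lnz)
... | inj₂ p≈0 with a ℚ.≟ 0ℚ
...   | yes a≡0 = inj₂ (∷-zero a≡0 p≈0)
...   | no  a≢0 = inj₁ (a ∷ [] , ∷-cong refl p≈0 , a≢0)

HasDegree : Poly → ℕ → Set
HasDegree f N = coeff f N ≢ 0ℚ × (∀ n → N ℕ.< n → coeff f n ≡ 0ℚ)

coeff-≥length : ∀ p n → length p ℕ.≤ n → coeff p n ≡ 0ℚ
coeff-≥length []      n       _         = refl
coeff-≥length (a ∷ p) (suc n) (s≤s p≤n) = coeff-≥length p n p≤n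

coeff-*P-≥length : ∀ p q n → length p ℕ.+ length q ℕ.≤ suc n → coeff (p *P q) n ≡ 0ℚ
coeff-*P-≥length []      q n _ = refl
coeff-*P-≥length (a ∷ p) q n (s≤s len≤n) = begin
  coeff ((a ∷ p) *P q) n                  ≡⟨ coeff-∷-*P a p q n ⟩
  a * coeff q n + coeff (0ℚ ∷ p *P q) n   ≡⟨ cong₂ (λ u v → a * u + v)
                                               (coeff-≥length q n (ℕP.m+n≤o⇒n≤o (length p) len≤n))
                                               (tail≡0 n len≤n) ⟩
  a * 0ℚ + 0ℚ                             ≡⟨ cong (_+ 0ℚ) (ℚP.*-zeroʳ a) ⟩
  0ℚ                                      ∎
  where
  open ≡-Reasoning
  tail≡0 : ∀ n → length p ℕ.+ length q ℕ.≤ n → coeff (0ℚ ∷ p *P q) n ≡ 0ℚ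
  tail≡0 zero    _   = refl
  tail≡0 (suc n) len≤n = coeff-*P-≥length p q n len≤n

coeff-*P-leading : ∀ p q m k → length p ≡ suc m → length q ≡ suc k →
                   coeff (p *P q) (m ℕ.+ k) ≡ coeff p m * coeff q k
coeff-*P-leading (a ∷ []) q zero k _ _ = begin
  coeff ((a ∷ []) *P q) k             ≡⟨ coeff-∷-*P a [] q k ⟩
  a * coeff q k + coeff (0ℚ ∷ []) k   ≡⟨ cong (_+_ (a * coeff q k)) (∷-zero refl (λ _ → refl) k) ⟩
  a * coeff q k + 0ℚ                  ≡⟨ ℚP.+-identityʳ (a * coeff q k) ⟩
  a * coeff q k                       ∎
  where open ≡-Reasoning
coeff-*P-leading (a ∷ b ∷ p) q (suc m) k len-p len-q = begin
  coeff ((a ∷ b ∷ p) *P q) (suc (m ℕ.+ k))   ≡⟨ coeff-∷-*P a (b ∷ p) q _ ⟩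
  a * coeff q (suc (m ℕ.+ k)) + C            ≡⟨ cong (λ u → a * u + C) (coeff-≥length q _ len-q≤) ⟩
  a * 0ℚ + C                                 ≡⟨ cong (_+ C) (ℚP.*-zeroʳ a) ⟩
  0ℚ + C                                     ≡⟨ ℚP.+-identityˡ C ⟩
  C                                          ≡⟨ coeff-*P-leading (b ∷ p) q m k
                                                 (ℕP.suc-injective len-p) len-q ⟩
  coeff (b ∷ p) m * coeff q k                ∎
  where
  open ≡-Reasoning
  C = coeff ((b ∷ p) *P q) (m ℕ.+ k)
  len-q≤ : length q ℕ.≤ suc (m ℕ.+ k)
  len-q≤ = subst (ℕ._≤ suc (m ℕ.+ k)) (sym len-q) (s≤s (ℕP.m≤n+m k m))

leading-coeff-nonzero : ∀ p → LeadingNonZero p → coeff p (ℕ.pred (length p)) ≢ 0ℚ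
leading-coeff-nonzero (a ∷ [])    lnz = lnz
leading-coeff-nonzero (a ∷ b ∷ p) lnz = leading-coeff-nonzero (b ∷ p) lnz

*-nonzero : ∀ {a b} → a ≢ 0ℚ → b ≢ 0ℚ → a * b ≢ 0ℚ
*-nonzero {a} {b} a≢0 b≢0 ab≡0 = b≢0 (begin
  b                    ≡⟨ ℚP.*-identityˡ b ⟨
  1ℚ * b               ≡⟨ cong (_* b) (ℚP.*-inverseˡ a) ⟨
  ℚ.1/ a * a * b       ≡⟨ ℚP.*-assoc (ℚ.1/ a) a b ⟩
  ℚ.1/ a * (a * b)     ≡⟨ cong (ℚ.1/ a *_) ab≡0 ⟩
  ℚ.1/ a * 0ℚ          ≡⟨ ℚP.*-zeroʳ (ℚ.1/ a) ⟩
  0ℚ                   ∎)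
  where
  open ≡-Reasoning
  instance
    a-nonZero : ℚ.NonZero a
    a-nonZero = ℚ.≢-nonZero a≢0

length-*P : ∀ f g h {N} → f ≈P g *P h → LeadingNonZero g → LeadingNonZero h → HasDegree f N →
            length g ℕ.+ length h ≡ 2 ℕ.+ N
length-*P f (a ∷ g) (b ∷ h) {N} f≈gh lnz-g lnz-h (fN≢0 , f>N≡0)
  with ℕP.<-cmp (length g ℕ.+ length h) N
... | tri< lt _ _ = ⊥-elim (fN≢0 (trans (f≈gh N) (coeff-*P-≥length (a ∷ g) (b ∷ h) N short)))
  where
  short : suc (length g ℕ.+ suc (length h)) ℕ.≤ suc N
  short = s≤s (subst (ℕ._≤ N) (sym (ℕP.+-suc (length g) (length h))) lt)
... | tri≈ _ eq _ = cong suc (trans (ℕP.+-suc (length g) (length h)) (cong suc eq))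
... | tri> _ _ gt = ⊥-elim (*-nonzero (leading-coeff-nonzero (a ∷ g) lnz-g)
                                      (leading-coeff-nonzero (b ∷ h) lnz-h) (begin
  coeff (a ∷ g) (length g) * coeff (b ∷ h) (length h)
    ≡⟨ coeff-*P-leading (a ∷ g) (b ∷ h) _ _ refl refl ⟨
  coeff ((a ∷ g) *P (b ∷ h)) (length g ℕ.+ length h)
    ≡⟨ f≈gh _ ⟨
  coeff f (length g ℕ.+ length h)
    ≡⟨ f>N≡0 _ gt ⟩
  0ℚ
    ∎))
  where open ≡-Reasoning

constant-unit : ∀ g a → g ≈P a ∷ [] → a ≢ 0ℚ → IsUnit g
constant-unit g a g≈a a≢0 =
  a⁻¹ , ≈P-trans (g *P a⁻¹) ((a ∷ []) *P a⁻¹) 1P (*P-congˡ g (a ∷ []) a⁻¹ g≈a) a*a⁻¹≈1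
  where
  instance
    a-nonZero : ℚ.NonZero a
    a-nonZero = ℚ.≢-nonZero a≢0
  a⁻¹ = ℚ.1/ a ∷ []
  a*a⁻¹≈1 : (a ∷ []) *P a⁻¹ ≈P 1P
  a*a⁻¹≈1 zero    = trans (ℚP.+-identityʳ _) (ℚP.*-inverseʳ a)
  a*a⁻¹≈1 (suc n) = refl

-- Quartics with a quadratic factor

-- (t² + a t + b)(t² + c t + d) = t⁴ + p t³ + q t² + r t + e
record MonicQuadraticFactorisation (p q r e : ℚ) : Set where
  field
    a b c d  : ℚ
    a+c≡p    : a + c ≡ p
    ac+b+d≡q : a * c + b + d ≡ q
    ad+bc≡r  : a * d + b * c ≡ r
    bd≡e     : b * d ≡ e

-- Since g₂h₂ = 1, the factors h₂·g and g₂·h are monic.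
monic-quadratic-factors : ∀ {p q r e} g₀ g₁ g₂ h₀ h₁ h₂ →
  e ∷ r ∷ q ∷ p ∷ 1ℚ ∷ [] ≈P (g₀ ∷ g₁ ∷ g₂ ∷ []) *P (h₀ ∷ h₁ ∷ h₂ ∷ []) →
  MonicQuadraticFactorisation p q r e
monic-quadratic-factors g₀ g₁ g₂ h₀ h₁ h₂ f≈gh = record
  { a = g₁ * h₂ ; b = g₀ * h₂ ; c = h₁ * g₂ ; d = h₀ * g₂
  ; a+c≡p    = trans (coeff₃ g₁ g₂ h₁ h₂) (sym (f≈gh 3))
  ; ac+b+d≡q = trans (coeff₂ g₀ g₁ g₂ h₀ h₁ h₂)
                 (trans (cong (λ u → g₀ * h₂ + (u + (g₂ * h₀ + 0ℚ))) (scaled (g₁ * h₁)))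
                   (sym (f≈gh 2)))
  ; ad+bc≡r  = trans (coeff₁ g₀ g₁ g₂ h₀ h₁ h₂) (trans (scaled _) (sym (f≈gh 1)))
  ; bd≡e     = trans (coeff₀ g₀ g₂ h₀ h₂) (trans (scaled _) (sym (f≈gh 0)))
  }
  where
  scaled : ∀ u → u * (g₂ * h₂) ≡ u
  scaled u = trans (cong (u *_) (sym (f≈gh 4))) (ℚP.*-identityʳ u)
  coeff₃ : ∀ g₁ g₂ h₁ h₂ → g₁ * h₂ + h₁ * g₂ ≡ g₁ * h₂ + g₂ * h₁
  coeff₃ = solve-∀ ℚ-ring
  coeff₂ : ∀ g₀ g₁ g₂ h₀ h₁ h₂ → g₁ * h₂ * (h₁ * g₂) + g₀ * h₂ + h₀ * g₂
                                 ≡ g₀ * h₂ + (g₁ * h₁ * (g₂ * h₂) + (g₂ * h₀ + 0ℚ))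
  coeff₂ = solve-∀ ℚ-ring
  coeff₁ : ∀ g₀ g₁ g₂ h₀ h₁ h₂ → g₁ * h₂ * (h₀ * g₂) + g₀ * h₂ * (h₁ * g₂)
                                 ≡ (g₀ * h₁ + (g₁ * h₀ + 0ℚ)) * (g₂ * h₂)
  coeff₁ = solve-∀ ℚ-ring
  coeff₀ : ∀ g₀ g₂ h₀ h₂ → g₀ * h₂ * (h₀ * g₂) ≡ (g₀ * h₀ + 0ℚ) * (g₂ * h₂)
  coeff₀ = solve-∀ ℚ-ring

resolvent : ℚ → ℚ → ℚ → ℚ → ℚ → ℚ
resolvent p q r e y = y * y * y - q * y * y + (p * r - ι (+ 4) * e) * y
                    - (p * p * e - ι (+ 4) * q * e + r * r)

resolvent-root : ∀ {p q r e} (M : MonicQuadraticFactorisation p q r e) →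
                 let open MonicQuadraticFactorisation M in resolvent p q r e (b + d) ≡ 0ℚ
resolvent-root record { a = a ; b = b ; c = c ; d = d
                      ; a+c≡p = refl ; ac+b+d≡q = refl ; ad+bc≡r = refl ; bd≡e = refl } =
  vanishes a b c d
  where
  vanishes : ∀ a b c d →
    let p = a + c ; q = a * c + b + d ; r = a * d + b * c ; e = b * d ; y = b + d in
    y * y * y - q * y * y + (p * r - ι (+ 4) * e) * y - (p * p * e - ι (+ 4) * q * e + r * r) ≡ 0ℚ
  vanishes = solve-∀ ℚ-ring

resolventℤ : ℤ → ℤ → ℤ → List ℤ
resolventℤ p q r = ℤ.- (p ℤ.* p ℤ.- + 4 ℤ.* q ℤ.+ r ℤ.* r) ∷ p ℤ.* r ℤ.- + 4 ∷ ℤ.- q ∷ []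

evalMonic-resolventℤ : ∀ p q r y → evalMonic (resolventℤ p q r) y ≡ resolvent (ι p) (ι q) (ι r) 1ℚ y
evalMonic-resolventℤ p q r y = begin
  ι c₀ + y * (ι c₁ + y * (ι c₂ + y * 1ℚ))
    ≡⟨ cong₂ (λ u v → u + y * v) c₀-ι (cong₂ (λ u v → u + y * (v + y * 1ℚ)) c₁-ι (ι-homo‿- q)) ⟩
  - (P * P - ι (+ 4) * Q + R * R) + y * ((P * R - ι (+ 4)) + y * (- Q + y * 1ℚ))
    ≡⟨ horner P Q R y ⟩
  resolvent P Q R 1ℚ y
    ∎
  where
  open ≡-Reasoning
  P = ι p
  Q = ι q
  R = ι r
  c₀ = ℤ.- (p ℤ.* p ℤ.- + 4 ℤ.* q ℤ.+ r ℤ.* r)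
  c₁ = p ℤ.* r ℤ.- + 4
  c₂ = ℤ.- q
  c₀-ι : ι c₀ ≡ - (P * P - ι (+ 4) * Q + R * R)
  c₀-ι = trans (ι-homo‿- (p ℤ.* p ℤ.- + 4 ℤ.* q ℤ.+ r ℤ.* r))
           (cong -_ (trans (ι-homo-+ (p ℤ.* p ℤ.- + 4 ℤ.* q) (r ℤ.* r))
             (cong₂ _+_ (trans (ι-homo-- (p ℤ.* p) (+ 4 ℤ.* q))
                          (cong₂ _-_ (ι-homo-* p p) (ι-homo-* (+ 4) q)))
                        (ι-homo-* r r))))
  c₁-ι : ι c₁ ≡ P * R - ι (+ 4)
  c₁-ι = trans (ι-homo-- (p ℤ.* r) (+ 4)) (cong (_- ι (+ 4)) (ι-homo-* p r))
  horner : ∀ P Q R y →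
    - (P * P - ι (+ 4) * Q + R * R) + y * ((P * R - ι (+ 4)) + y * (- Q + y * 1ℚ))
    ≡ y * y * y - Q * y * y + (P * R - ι (+ 4) * 1ℚ) * y - (P * P * 1ℚ - ι (+ 4) * Q * 1ℚ + R * R)
  horner = solve-∀ ℚ-ring

∣i∣≡1⇒i≡±1 : ∀ i → ℤ.∣ i ∣ ≡ 1 → i ≡ 1ℤ ⊎ i ≡ -1ℤ
∣i∣≡1⇒i≡±1 (+ 1)         _ = inj₁ refl
∣i∣≡1⇒i≡±1 ℤ.-[1+ 0 ]    _ = inj₂ refl
∣i∣≡1⇒i≡±1 (+ 0)         ()
∣i∣≡1⇒i≡±1 (+ suc (suc n)) ()
∣i∣≡1⇒i≡±1 ℤ.-[1+ suc n ] ()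

i*j≡1⇒i≡j≡±1 : ∀ i j → i ℤ.* j ≡ 1ℤ → (i ≡ 1ℤ × j ≡ 1ℤ) ⊎ (i ≡ -1ℤ × j ≡ -1ℤ)
i*j≡1⇒i≡j≡±1 i j ij≡1
  with ∣i∣≡1⇒i≡±1 i (ℕP.m*n≡1⇒m≡1 ℤ.∣ i ∣ ℤ.∣ j ∣ ∣i∣∣j∣≡1)
     | ∣i∣≡1⇒i≡±1 j (ℕP.m*n≡1⇒n≡1 ℤ.∣ i ∣ ℤ.∣ j ∣ ∣i∣∣j∣≡1)
  where
  ∣i∣∣j∣≡1 : ℤ.∣ i ∣ ℕ.* ℤ.∣ j ∣ ≡ 1
  ∣i∣∣j∣≡1 = trans (sym (ℤP.abs-* i j)) (cong ℤ.∣_∣ ij≡1)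
... | inj₁ refl | inj₁ refl = inj₁ (refl , refl)
... | inj₂ refl | inj₂ refl = inj₂ (refl , refl)
... | inj₁ refl | inj₂ refl = contradiction ij≡1 λ ()
... | inj₂ refl | inj₁ refl = contradiction ij≡1 λ ()

reciprocals-with-integer-sum : ∀ {b d Y} → b * d ≡ 1ℚ → b + d ≡ ι Y →
                               (b ≡ 1ℚ × d ≡ 1ℚ) ⊎ (b ≡ - 1ℚ × d ≡ - 1ℚ)
reciprocals-with-integer-sum {b} {d} {Y} bd≡1 b+d≡Y =
  let B , b≡B = rational-root-theorem (1ℤ ∷ ℤ.- Y ∷ []) b b-root
  in  signs b≡B (i*j≡1⇒i≡j≡±1 B (Y ℤ.- B) (B*[Y-B]≡1 {B} b≡B))
  where
  open ≡-Reasoning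
  b-root : evalMonic (1ℤ ∷ ℤ.- Y ∷ []) b ≡ 0ℚ
  b-root = begin
    1ℚ + b * (ι (ℤ.- Y) + b * 1ℚ)   ≡⟨ cong (λ v → 1ℚ + b * (v + b * 1ℚ))
                                          (trans (ι-homo‿- Y) (cong -_ (sym b+d≡Y))) ⟩
    1ℚ + b * (- (b + d) + b * 1ℚ)    ≡⟨ expand b d ⟩
    1ℚ - b * d                        ≡⟨ cong (_-_ 1ℚ) bd≡1 ⟩
    0ℚ                                ∎
    where
    expand : ∀ b d → 1ℚ + b * (- (b + d) + b * 1ℚ) ≡ 1ℚ - b * d
    expand = solve-∀ ℚ-ring
  d≡ι[Y-B] : ∀ {B} → b ≡ ι B → d ≡ ι (Y ℤ.- B)
  d≡ι[Y-B] {B} b≡B = begin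
    d                 ≡⟨ cancel b d ⟩
    (b + d) - b       ≡⟨ cong₂ _-_ b+d≡Y b≡B ⟩
    ι Y - ι B         ≡⟨ ι-homo-- Y B ⟨
    ι (Y ℤ.- B)       ∎
    where
    cancel : ∀ b d → d ≡ (b + d) - b
    cancel = solve-∀ ℚ-ring
  B*[Y-B]≡1 : ∀ {B} → b ≡ ι B → B ℤ.* (Y ℤ.- B) ≡ 1ℤ
  B*[Y-B]≡1 {B} b≡B = ι-injective (begin
    ι (B ℤ.* (Y ℤ.- B))   ≡⟨ ι-homo-* B (Y ℤ.- B) ⟩
    ι B * ι (Y ℤ.- B)     ≡⟨ cong₂ _*_ b≡B (d≡ι[Y-B] b≡B) ⟨
    b * d                 ≡⟨ bd≡1 ⟩
    1ℚ                    ∎)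
  signs : ∀ {B} → b ≡ ι B → (B ≡ 1ℤ × Y ℤ.- B ≡ 1ℤ) ⊎ (B ≡ -1ℤ × Y ℤ.- B ≡ -1ℤ) →
          (b ≡ 1ℚ × d ≡ 1ℚ) ⊎ (b ≡ - 1ℚ × d ≡ - 1ℚ)
  signs b≡B (inj₁ (B≡1 , D≡1))  = inj₁ (trans b≡B (cong ι B≡1) , trans (d≡ι[Y-B] b≡B) (cong ι D≡1))
  signs b≡B (inj₂ (B≡-1 , D≡-1)) =
    inj₂ (trans b≡B (cong ι B≡-1) , trans (d≡ι[Y-B] b≡B) (cong ι D≡-1))

module _ {p q r : ℤ} (M : MonicQuadraticFactorisation (ι p) (ι q) (ι r) 1ℚ) where
  open MonicQuadraticFactorisation M

  b+d-integral : ∃ λ Y → b + d ≡ ι Y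
  b+d-integral = rational-root-theorem (resolventℤ p q r) (b + d)
                   (trans (evalMonic-resolventℤ p q r (b + d)) (resolvent-root M))

  a-integral : ∀ {Y} → b + d ≡ ι Y → ∃ λ A → evalMonicℤ (q ℤ.- Y ∷ ℤ.- p ∷ []) A ≡ 0ℤ
  a-integral {Y} b+d≡Y =
    let A , _ , root = monic-root-integral (q ℤ.- Y ∷ ℤ.- p ∷ []) a a-root in A , root
    where
    open ≡-Reasoning
    a-root : evalMonic (q ℤ.- Y ∷ ℤ.- p ∷ []) a ≡ 0ℚ
    a-root = begin
      ι (q ℤ.- Y) + a * (ι (ℤ.- p) + a * 1ℚ)
        ≡⟨ cong₂ (λ u v → u + a * (v + a * 1ℚ)) (ι-homo-- q Y) (ι-homo‿- p) ⟩
      ι q - ι Y + a * (- ι p + a * 1ℚ)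
        ≡⟨ cong₂ (λ u v → u - v + a * (- ι p + a * 1ℚ)) ac+b+d≡q b+d≡Y ⟨
      a * c + b + d - (b + d) + a * (- ι p + a * 1ℚ)
        ≡⟨ cong (λ w → a * c + b + d - (b + d) + a * (- w + a * 1ℚ)) a+c≡p ⟨
      a * c + b + d - (b + d) + a * (- (a + c) + a * 1ℚ)
        ≡⟨ vanishes a b c d ⟩
      0ℚ
        ∎
      where
      vanishes : ∀ a b c d → a * c + b + d - (b + d) + a * (- (a + c) + a * 1ℚ) ≡ 0ℚ
      vanishes = solve-∀ ℚ-ring

  quadratic-factors-integral :
    (p ≡ r × ∃ λ A → evalMonicℤ (q ℤ.- + 2 ∷ ℤ.- p ∷ []) A ≡ 0ℤ) ⊎
    (∃ λ A → evalMonicℤ (q ℤ.+ + 2 ∷ ℤ.- p ∷ []) A ≡ 0ℤ)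
  quadratic-factors-integral =
    let Y , b+d≡Y = b+d-integral
    in  from-constant-terms (reciprocals-with-integer-sum {b} {d} {Y} bd≡e b+d≡Y)
    where
    open ≡-Reasoning
    from-constant-terms : (b ≡ 1ℚ × d ≡ 1ℚ) ⊎ (b ≡ - 1ℚ × d ≡ - 1ℚ) →
      (p ≡ r × ∃ λ A → evalMonicℤ (q ℤ.- + 2 ∷ ℤ.- p ∷ []) A ≡ 0ℤ) ⊎
      (∃ λ A → evalMonicℤ (q ℤ.+ + 2 ∷ ℤ.- p ∷ []) A ≡ 0ℤ)
    from-constant-terms (inj₁ (b≡1 , d≡1)) =
      inj₁ (p≡r , a-integral {+ 2} (trans (cong₂ _+_ b≡1 d≡1) (sym (ι-homo-+ 1ℤ 1ℤ))))
      where
      p≡r : p ≡ r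
      p≡r = ι-injective (begin
        ι p                 ≡⟨ a+c≡p ⟨
        a + c               ≡⟨ cong₂ _+_ (ℚP.*-identityʳ a) (ℚP.*-identityˡ c) ⟨
        a * 1ℚ + 1ℚ * c     ≡⟨ cong₂ (λ u v → a * u + v * c) d≡1 b≡1 ⟨
        a * d + b * c       ≡⟨ ad+bc≡r ⟩
        ι r                 ∎)
    from-constant-terms (inj₂ (b≡-1 , d≡-1)) = inj₂ (a-integral {ℤ.- + 2} (begin
      b + d                  ≡⟨ cong₂ _+_ b≡-1 d≡-1 ⟩
      - ι 1ℤ + - ι 1ℤ        ≡⟨ ℚP.neg-distrib-+ (ι 1ℤ) (ι 1ℤ) ⟨
      - (ι 1ℤ + ι 1ℤ)        ≡⟨ cong -_ (ι-homo-+ 1ℤ 1ℤ) ⟨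
      - ι (+ 2)              ≡⟨ ι-homo‿- (+ 2) ⟨
      ι (ℤ.- + 2)            ∎))

α β : ℤ → ℤ
α s = ℤ.- (+ 6) ℤ.* s ℤ.* s ℤ.- + 6
β s = + 4 ℤ.* s ℤ.* s ℤ.* s ℤ.- + 4 ℤ.* s ℤ.* s ℤ.+ + 8 ℤ.* s ℤ.- + 4

F-monic : ℤ → List ℤ
F-monic s = 1ℤ ∷ + 4 ∷ α s ∷ β s ∷ []

monicᴱ : List Expr → Expr
monicᴱ []       = con 1ℤ
monicᴱ (e ∷ es) = e ⊕ x̂ ⊗ monicᴱ es

-- ⟦ αᴱ ⟧ x s and ⟦ βᴱ ⟧ x s reduce to α s and β s, so the integer equations below
-- can be passed to no-common-root as they are.
αᴱ βᴱ : Expr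
αᴱ = ⊝ con (+ 6) ⊗ ŷ ⊗ ŷ ⊖ con (+ 6)
βᴱ = con (+ 4) ⊗ ŷ ⊗ ŷ ⊗ ŷ ⊖ con (+ 4) ⊗ ŷ ⊗ ŷ ⊕ con (+ 8) ⊗ ŷ ⊖ con (+ 4)

eval-F : ∀ s x → eval (F s) x ≡ evalMonic (F-monic s) x
eval-F s x = cong (λ v → 1ℚ + x * (ι (+ 4) + x * (ι (α s) + x * (ι (β s) + x * v))))
                  (trans (cong (_+_ 1ℚ) (ℚP.*-zeroʳ x)) (ℚP.+-identityʳ 1ℚ))

F-no-integer-root : ∀ s z → evalMonicℤ (F-monic s) z ≢ 0ℤ
F-no-integer-root s z Fz≡0 =
  no-common-root 8 Fᴱ (con 0ℤ) (from-yes (noCommonRootMod? 8 Fᴱ (con 0ℤ))) z s Fz≡0 refl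
  where Fᴱ = monicᴱ (con 1ℤ ∷ con (+ 4) ∷ αᴱ ∷ βᴱ ∷ [])

F-no-rational-root : ∀ s x → eval (F s) x ≢ 0ℚ
F-no-rational-root s x Fx≡0 =
  let z , _ , Fz≡0 = monic-root-integral (F-monic s) x (trans (sym (eval-F s x)) Fx≡0)
  in  F-no-integer-root s z Fz≡0

F-no-linear-factorˡ : ∀ s g₀ g₁ h → length h ≡ 4 → ¬ F s ≈P (g₀ ∷ g₁ ∷ []) *P h
F-no-linear-factorˡ s g₀ g₁ h len-h F≈gh =
  F-no-rational-root s x
    (root-of-factorˡ (F s) (g₀ ∷ g₁ ∷ []) h x F≈gh (root-of-linear g₀ g₁ g₁h₃≡1))
  where
  x = - (g₀ * coeff h 3)
  g₁h₃≡1 : g₁ * coeff h 3 ≡ 1ℚ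
  g₁h₃≡1 = sym (trans (F≈gh 4) (coeff-*P-leading (g₀ ∷ g₁ ∷ []) h 1 3 refl len-h))

F-no-linear-factorʳ : ∀ s g h₀ h₁ → length g ≡ 4 → ¬ F s ≈P g *P (h₀ ∷ h₁ ∷ [])
F-no-linear-factorʳ s g h₀ h₁ len-g F≈gh =
  F-no-rational-root s x
    (root-of-factorʳ (F s) g (h₀ ∷ h₁ ∷ []) x F≈gh (root-of-linear h₀ h₁ h₁g₃≡1))
  where
  x = - (h₀ * coeff g 3)
  h₁g₃≡1 : h₁ * coeff g 3 ≡ 1ℚ
  h₁g₃≡1 = trans (ℚP.*-comm h₁ (coeff g 3))
             (sym (trans (F≈gh 4) (coeff-*P-leading g (h₀ ∷ h₁ ∷ []) 3 1 len-g refl)))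

F-no-quadratic-factor : ∀ s g₀ g₁ g₂ h₀ h₁ h₂ → ¬ F s ≈P (g₀ ∷ g₁ ∷ g₂ ∷ []) *P (h₀ ∷ h₁ ∷ h₂ ∷ [])
F-no-quadratic-factor s g₀ g₁ g₂ h₀ h₁ h₂ F≈gh =
  excluded (quadratic-factors-integral {β s} {α s} {+ 4}
             (monic-quadratic-factors g₀ g₁ g₂ h₀ h₁ h₂ F≈gh))
  where
  excluded : (β s ≡ + 4 × ∃ λ A → evalMonicℤ (α s ℤ.- + 2 ∷ ℤ.- β s ∷ []) A ≡ 0ℤ) ⊎
             (∃ λ A → evalMonicℤ (α s ℤ.+ + 2 ∷ ℤ.- β s ∷ []) A ≡ 0ℤ) → ⊥
  excluded (inj₁ (β≡4 , A , root)) =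
    no-common-root 5 (βᴱ ⊖ con (+ 4)) quadᴱ (from-yes (noCommonRootMod? 5 (βᴱ ⊖ con (+ 4)) quadᴱ))
      A s (cong (ℤ._- + 4) β≡4) root
    where quadᴱ = monicᴱ (αᴱ ⊖ con (+ 2) ∷ ⊝ βᴱ ∷ [])
  excluded (inj₂ (A , root)) =
    no-common-root 3 quadᴱ (con 0ℤ) (from-yes (noCommonRootMod? 3 quadᴱ (con 0ℤ))) A s root refl
    where quadᴱ = monicᴱ (αᴱ ⊕ con (+ 2) ∷ ⊝ βᴱ ∷ [])

F-degree : ∀ s → HasDegree (F s) 4
F-degree s = (λ ()) , λ n → coeff-≥length (F s) n

1P-degree : HasDegree 1P 0
1P-degree = (λ ()) , λ n → coeff-≥length 1P n

F-factor-lengths : ∀ s g h → LeadingNonZero g → LeadingNonZero h → F s ≈P g *P h →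
                   length g ℕ.+ length h ≡ 6 → length g ≡ 1 ⊎ length h ≡ 1
F-factor-lengths s (_ ∷ [])                  _   _ _ _    _   = inj₁ refl
F-factor-lengths s (g₀ ∷ g₁ ∷ [])            h   _ _ F≈gh len =
  ⊥-elim (F-no-linear-factorˡ s g₀ g₁ h (ℕP.+-cancelˡ-≡ 2 (length h) 4 len) F≈gh)
F-factor-lengths s (g₀ ∷ g₁ ∷ g₂ ∷ []) (h₀ ∷ h₁ ∷ h₂ ∷ []) _ _ F≈gh _ =
  ⊥-elim (F-no-quadratic-factor s g₀ g₁ g₂ h₀ h₁ h₂ F≈gh)
F-factor-lengths s g@(_ ∷ _ ∷ _ ∷ _ ∷ [])   (h₀ ∷ h₁ ∷ []) _ _ F≈gh _ =
  ⊥-elim (F-no-linear-factorʳ s g h₀ h₁ refl F≈gh)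
F-factor-lengths s (_ ∷ _ ∷ _ ∷ _ ∷ _ ∷ []) h   _ _ _    len =
  inj₂ (ℕP.+-cancelˡ-≡ 5 (length h) 1 len)
F-factor-lengths s (_ ∷ _ ∷ _ ∷ _ ∷ _ ∷ _ ∷ g) []      _ () _ _
F-factor-lengths s (_ ∷ _ ∷ _ ∷ _ ∷ _ ∷ _ ∷ g) (_ ∷ h) _ _  _ len =
  ⊥-elim (ℕP.m+1+n≢0 (length g) (ℕP.+-cancelˡ-≡ 6 (length g ℕ.+ suc (length h)) 0 len))

F≉0 : ∀ s → ¬ F s ≈P 0P
F≉0 s F≈0 = contradiction (F≈0 0) λ ()

F-not-unit : ∀ s → ¬ IsUnit (F s)
F-not-unit s (q , Fq≈1) = excluded (trim q)
  where
  excluded : (∃ λ q′ → q ≈P q′ × LeadingNonZero q′) ⊎ q ≈P 0P → ⊥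
  excluded (inj₁ (q′ , q≈q′ , lnz)) =
    contradiction (length-*P 1P (F s) q′ 1≈Fq′ (λ ()) lnz 1P-degree) λ ()
    where
    1≈Fq′ : 1P ≈P F s *P q′
    1≈Fq′ = ≈P-trans 1P (F s *P q) (F s *P q′)
              (≈P-sym (F s *P q) 1P Fq≈1) (*P-congʳ (F s) q q′ q≈q′)
  excluded (inj₂ q≈0) = contradiction (trans (sym (Fq≈1 0)) (*P-zeroʳ (F s) q q≈0 0)) λ ()

constant-factor-unit : ∀ g g′ → g ≈P g′ → LeadingNonZero g′ → length g′ ≡ 1 → IsUnit g
constant-factor-unit g (a ∷ []) g≈a a≢0 _ = constant-unit g a g≈a a≢0

F-factor-unit : ∀ s g h → F s ≈P g *P h → IsUnit g ⊎ IsUnit h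
F-factor-unit s g h F≈gh = from-trimmed (trim g) (trim h)
  where
  from-trimmed : (∃ λ g′ → g ≈P g′ × LeadingNonZero g′) ⊎ g ≈P 0P →
                 (∃ λ h′ → h ≈P h′ × LeadingNonZero h′) ⊎ h ≈P 0P → IsUnit g ⊎ IsUnit h
  from-trimmed (inj₂ g≈0) _ = ⊥-elim (F≉0 s (≈P-trans (F s) (g *P h) 0P F≈gh (*P-zeroˡ g h g≈0)))
  from-trimmed _ (inj₂ h≈0) = ⊥-elim (F≉0 s (≈P-trans (F s) (g *P h) 0P F≈gh (*P-zeroʳ g h h≈0)))
  from-trimmed (inj₁ (g′ , g≈g′ , lnz-g)) (inj₁ (h′ , h≈h′ , lnz-h)) =
    ⊎.map (constant-factor-unit g g′ g≈g′ lnz-g) (constant-factor-unit h h′ h≈h′ lnz-h)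
          (F-factor-lengths s g′ h′ lnz-g lnz-h F≈g′h′
            (length-*P (F s) g′ h′ F≈g′h′ lnz-g lnz-h (F-degree s)))
    where
    F≈g′h′ : F s ≈P g′ *P h′
    F≈g′h′ = ≈P-trans (F s) (g *P h) (g′ *P h′) F≈gh
               (≈P-trans (g *P h) (g′ *P h) (g′ *P h′)
                 (*P-congˡ g g′ h g≈g′) (*P-congʳ g′ h h′ h≈h′))

lemma3p3 : (s : ℤ) → Irreducible (F s)
lemma3p3 s = F≉0 s , F-not-unit s , F-factor-unit s
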